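{- Let $k\ge 1$ and $A\ge 5$ be integers with $A\equiv 1\pmod{4}$. Then $f(x)=x^{2^{k+1}}+Ax^{2^k}+A$ is not monogenic.
   Context: A monic polynomial $f(x)\in\mathbb{Z}[x]$ is called monogenic if it is irreducible over $\mathbb{Q}$ and, for a root $\theta$ of $f$ and $K=\mathbb{Q}(\theta)$, the ring of integers of $K$ equals $\mathbb{Z}[\theta]$. -}

module Defs where

open import Data.Nat as ℕ using (ℕ; zero; suc; _≤_; _^_)
open import Data.Integer as ℤ using (ℤ)
open import Data.Rational as ℚ using (ℚ; 0ℚ; 1ℚ)
open import Data.List using (List; []; _∷_; map; replicate; _++_)
open import Data.Product using (Σ; _×_; ∃)
open import Data.Sum using (_⊎_)
open import Relation.Binary.PropositionalEquality using (_≡_)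

-- Polynomials are coefficient lists, lowest degree first
-- ([a₀, a₁, …, aₙ] represents a₀ + a₁x + … + aₙxⁿ); trailing zeros allowed.
PolyQ : Set
PolyQ = List ℚ

PolyZ : Set
PolyZ = List ℤ

toℚ : ℤ → ℚ
toℚ z = z ℚ./ 1

toQ[x] : PolyZ → PolyQ
toQ[x] = map toℚ

coeff : PolyQ → ℕ → ℚ
coeff []       _       = 0ℚ
coeff (c ∷ cs) zero    = c
coeff (c ∷ cs) (suc i) = coeff cs i

_≈ₚ_ : PolyQ → PolyQ → Set
p ≈ₚ q = ∀ i → coeff p i ≡ coeff q i

infixl 6 _+ₚ_ _-ₚ_
infixl 7 _*ₚ_ _·ₚ_

_+ₚ_ : PolyQ → PolyQ → PolyQ
[]       +ₚ q        = q
(a ∷ p)  +ₚ []       = a ∷ p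
(a ∷ p)  +ₚ (b ∷ q)  = (a ℚ.+ b) ∷ (p +ₚ q)

_·ₚ_ : ℚ → PolyQ → PolyQ
c ·ₚ p = map (c ℚ.*_) p

-ₚ_ : PolyQ → PolyQ
-ₚ p = map ℚ.-_ p

_-ₚ_ : PolyQ → PolyQ → PolyQ
p -ₚ q = p +ₚ (-ₚ q)

_*ₚ_ : PolyQ → PolyQ → PolyQ
[]      *ₚ q = []
(a ∷ p) *ₚ q = (a ·ₚ q) +ₚ (0ℚ ∷ (p *ₚ q))

-- composition g(p(x)) (Horner)
compose : PolyQ → PolyQ → PolyQ
compose []       p = []
compose (c ∷ cs) p = (c ∷ []) +ₚ (p *ₚ compose cs p)

_∣ₚ_ : PolyQ → PolyQ → Set
f ∣ₚ g = Σ PolyQ λ q → (f *ₚ q) ≈ₚ g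

IsConstant : PolyQ → Set
IsConstant g = ∀ i → 1 ≤ i → coeff g i ≡ 0ℚ

IrreducibleQ : PolyQ → Set
IrreducibleQ f =
  (IsConstant f → Data.Empty.⊥) ×
  (∀ g h → f ≈ₚ (g *ₚ h) → IsConstant g ⊎ IsConstant h)
  where import Data.Empty

-- Number field K = ℚ(θ), θ a root of the irreducible polynomial f, modelled as
-- ℚ[x]/(f): an element of K is represented by any p ∈ ℚ[x] (standing for p(θ)),
-- and p(θ) = q(θ) iff f ∣ (p - q).

-- monic integer polynomial: cs ++ [1]
MonicZ : Set
MonicZ = List ℤ

monicPoly : MonicZ → PolyZ
monicPoly cs = cs ++ (ℤ.+ 1 ∷ [])

-- p(θ) is an algebraic integer: it is a root of some monic g ∈ ℤ[x]
IsAlgInt : PolyZ → PolyQ → Set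
IsAlgInt f p = Σ MonicZ λ g → toQ[x] f ∣ₚ compose (toQ[x] (monicPoly g)) p

InZθ : PolyZ → PolyQ → Set
InZθ f p = Σ PolyZ λ q → toQ[x] f ∣ₚ (p -ₚ toQ[x] q)

-- monogenic: irreducible over ℚ and O_K = ℤ[θ]
Monogenic : PolyZ → Set
Monogenic f =
  IrreducibleQ (toQ[x] f) ×
  ((∀ p → IsAlgInt f p → InZθ f p) × (∀ p → InZθ f p → IsAlgInt f p))

_+z_ : PolyZ → PolyZ → PolyZ
[]       +z q        = q
(a ∷ p)  +z []       = a ∷ p
(a ∷ p)  +z (b ∷ q)  = (a ℤ.+ b) ∷ (p +z q)

monomial : ℕ → ℤ → PolyZ
monomial n c = replicate n (ℤ.+ 0) ++ (c ∷ [])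

fPoly : ℕ → ℤ → PolyZ
fPoly k A = monomial (2 ^ suc k) (ℤ.+ 1) +z (monomial (2 ^ k) A +z monomial 0 A)

{-# OPTIONS --safe #-}
-- Let A = 4m + 1 and z = θ^(2^(k−1)), so that z⁴ + Az² + A = 0. The element (1 + z + z²)/2
-- is an algebraic integer, being a root of a monic quartic over ℤ, but it is not in ℤ[θ]:
-- dividing by the monic integral f preserves integrality of coefficients, so an element of
-- ℤ[θ] given by a polynomial of degree below deg f has integral coefficients, while this one
-- has constant coefficient ½.
module Submission where

open import Defs
open import Data.Nat using (ℕ; _≤_)
open import Data.Integer using (ℤ; _%_; +_)
open import Relation.Binary.PropositionalEquality using (_≡_)
open import Relation.Nullary using (¬_)
import Data.Integer

open import Data.Nat as ℕ using (zero; suc; _<_; z≤n; s≤s; _+_; _*_; _^_)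
import Data.Nat.Properties as ℕ
import Data.Integer as ℤ
import Data.Integer.DivMod as ℤ
import Data.Integer.Properties as ℤ
open import Data.Rational as ℚ using (ℚ; 0ℚ; 1ℚ; ½)
import Data.Rational.Properties as ℚ
open import Data.Rational.Unnormalised as ℚᵘ using (mkℚᵘ; *≡*)
import Data.Rational.Unnormalised.Properties as ℚᵘ
import Data.Rational.Solver as ℚ-Solver
open import Data.List using (List; []; _∷_; replicate; _++_; length)
open import Data.List.Relation.Binary.Pointwise using (Pointwise; []; _∷_)
open import Data.Product using (Σ; _×_; _,_; proj₁; proj₂)
open import Data.Sum using (inj₁; inj₂)
open import Data.Maybe using (Maybe; just; nothing)
open import Data.Vec using ([]; _∷_)
open import Data.Fin using () renaming (zero to #0; suc to #s)
open import Relation.Nullary using (yes; no)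
open import Relation.Binary.PropositionalEquality
  using (_≢_; refl; sym; trans; cong; cong₂; module ≡-Reasoning)
open import Relation.Binary.Bundles using (Setoid)
open import Algebra.Bundles using (CommutativeRing)
import Algebra.Solver.Ring.AlmostCommutativeRing as ACR
import Algebra.Solver.Ring
import Algebra.Properties.Semiring.Exp

-- Arithmetic in ℚ[x]

-- A record, so that the two polynomials can be inferred from a proof.
infix 4 _≋_
record _≋_ (p q : PolyQ) : Set where
  constructor coeffwise
  field coeff-≡ : p ≈ₚ q
open _≋_

≋-refl : ∀ {p} → p ≋ p
≋-refl = coeffwise λ _ → refl

≋-sym : ∀ {p q} → p ≋ q → q ≋ p
≋-sym (coeffwise e) = coeffwise λ i → sym (e i)

≋-trans : ∀ {p q r} → p ≋ q → q ≋ r → p ≋ r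
≋-trans (coeffwise e) (coeffwise e′) = coeffwise λ i → trans (e i) (e′ i)

≋-setoid : Setoid _ _
≋-setoid = record
  { Carrier = PolyQ ; _≈_ = _≋_
  ; isEquivalence = record { refl = ≋-refl ; sym = ≋-sym ; trans = ≋-trans } }

coeff-+ : ∀ p q i → coeff (p +ₚ q) i ≡ coeff p i ℚ.+ coeff q i
coeff-+ []      q       i       = sym (ℚ.+-identityˡ _)
coeff-+ (a ∷ p) []      i       = sym (ℚ.+-identityʳ _)
coeff-+ (a ∷ p) (b ∷ q) zero    = refl
coeff-+ (a ∷ p) (b ∷ q) (suc i) = coeff-+ p q i

coeff-· : ∀ c p i → coeff (c ·ₚ p) i ≡ c ℚ.* coeff p i
coeff-· c []      i       = sym (ℚ.*-zeroʳ c)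
coeff-· c (a ∷ p) zero    = refl
coeff-· c (a ∷ p) (suc i) = coeff-· c p i

coeff-neg : ∀ p i → coeff (-ₚ p) i ≡ ℚ.- coeff p i
coeff-neg []      i       = refl
coeff-neg (a ∷ p) zero    = refl
coeff-neg (a ∷ p) (suc i) = coeff-neg p i

+-cong : ∀ {p p′ q q′} → p ≋ p′ → q ≋ q′ → p +ₚ q ≋ p′ +ₚ q′
+-cong {p} {p′} {q} {q′} (coeffwise e) (coeffwise e′) = coeffwise λ i →
  trans (coeff-+ p q i) (trans (cong₂ ℚ._+_ (e i) (e′ i)) (sym (coeff-+ p′ q′ i)))

·-cong : ∀ {c d p q} → c ≡ d → p ≋ q → c ·ₚ p ≋ d ·ₚ q
·-cong {c} {d} {p} {q} c≡d (coeffwise e) = coeffwise λ i →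
  trans (coeff-· c p i) (trans (cong₂ ℚ._*_ c≡d (e i)) (sym (coeff-· d q i)))

neg-cong : ∀ {p q} → p ≋ q → -ₚ p ≋ -ₚ q
neg-cong {p} {q} (coeffwise e) = coeffwise λ i →
  trans (coeff-neg p i) (trans (cong ℚ.-_ (e i)) (sym (coeff-neg q i)))

∷-cong : ∀ {a b p q} → a ≡ b → p ≋ q → a ∷ p ≋ b ∷ q
∷-cong a≡b (coeffwise e) = coeffwise λ { zero → a≡b ; (suc i) → e i }

∷-≋-[] : ∀ {a p} → a ≡ 0ℚ → p ≋ [] → a ∷ p ≋ []
∷-≋-[] a≡0 (coeffwise e) = coeffwise λ { zero → a≡0 ; (suc i) → e i }

∷-injectiveˡ : ∀ {a b p q} → a ∷ p ≋ b ∷ q → a ≡ b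
∷-injectiveˡ (coeffwise e) = e zero

∷-injectiveʳ : ∀ {a b p q} → a ∷ p ≋ b ∷ q → p ≋ q
∷-injectiveʳ (coeffwise e) = coeffwise λ i → e (suc i)

∷-≋-[]-head : ∀ {a p} → a ∷ p ≋ [] → a ≡ 0ℚ
∷-≋-[]-head (coeffwise e) = e zero

∷-≋-[]-tail : ∀ {a p} → a ∷ p ≋ [] → p ≋ []
∷-≋-[]-tail (coeffwise e) = coeffwise λ i → e (suc i)

+-assoc : ∀ p q r → (p +ₚ q) +ₚ r ≋ p +ₚ (q +ₚ r)
+-assoc p q r = coeffwise λ i → begin
  coeff ((p +ₚ q) +ₚ r) i                 ≡⟨ coeff-+ (p +ₚ q) r i ⟩
  coeff (p +ₚ q) i ℚ.+ coeff r i          ≡⟨ cong (ℚ._+ coeff r i) (coeff-+ p q i) ⟩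
  (coeff p i ℚ.+ coeff q i) ℚ.+ coeff r i ≡⟨ ℚ.+-assoc (coeff p i) (coeff q i) (coeff r i) ⟩
  coeff p i ℚ.+ (coeff q i ℚ.+ coeff r i) ≡⟨ cong (coeff p i ℚ.+_) (coeff-+ q r i) ⟨
  coeff p i ℚ.+ coeff (q +ₚ r) i          ≡⟨ coeff-+ p (q +ₚ r) i ⟨
  coeff (p +ₚ (q +ₚ r)) i                 ∎
  where open ≡-Reasoning

+-comm : ∀ p q → p +ₚ q ≋ q +ₚ p
+-comm p q = coeffwise λ i →
  trans (coeff-+ p q i) (trans (ℚ.+-comm (coeff p i) (coeff q i)) (sym (coeff-+ q p i)))

+-identityʳ : ∀ p → p +ₚ [] ≋ p
+-identityʳ p = coeffwise λ i → trans (coeff-+ p [] i) (ℚ.+-identityʳ (coeff p i))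

+-inverseˡ : ∀ p → (-ₚ p) +ₚ p ≋ []
+-inverseˡ p = coeffwise λ i → trans (coeff-+ (-ₚ p) p i)
  (trans (cong (ℚ._+ coeff p i) (coeff-neg p i)) (ℚ.+-inverseˡ (coeff p i)))

+-interchange : ∀ w x y z → (w +ₚ x) +ₚ (y +ₚ z) ≋ (w +ₚ y) +ₚ (x +ₚ z)
+-interchange w x y z = coeffwise λ i → begin
  coeff ((w +ₚ x) +ₚ (y +ₚ z)) i
    ≡⟨ trans (coeff-+ (w +ₚ x) (y +ₚ z) i) (cong₂ ℚ._+_ (coeff-+ w x i) (coeff-+ y z i)) ⟩
  (coeff w i ℚ.+ coeff x i) ℚ.+ (coeff y i ℚ.+ coeff z i)
    ≡⟨ interchange (coeff w i) (coeff x i) (coeff y i) (coeff z i) ⟩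
  (coeff w i ℚ.+ coeff y i) ℚ.+ (coeff x i ℚ.+ coeff z i)
    ≡⟨ trans (coeff-+ (w +ₚ y) (x +ₚ z) i) (cong₂ ℚ._+_ (coeff-+ w y i) (coeff-+ x z i)) ⟨
  coeff ((w +ₚ y) +ₚ (x +ₚ z)) i ∎
  where
  open ≡-Reasoning
  open ℚ-Solver.+-*-Solver
  interchange : ∀ w x y z → (w ℚ.+ x) ℚ.+ (y ℚ.+ z) ≡ (w ℚ.+ y) ℚ.+ (x ℚ.+ z)
  interchange = solve 4 (λ w x y z → (w :+ x) :+ (y :+ z) := (w :+ y) :+ (x :+ z)) refl

+-swapˡ : ∀ x y z → x +ₚ (y +ₚ z) ≋ y +ₚ (x +ₚ z)
+-swapˡ x y z = ≋-trans (≋-sym (+-assoc x y z))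
  (≋-trans (+-cong (+-comm x y) ≋-refl) (+-assoc y x z))

·-zeroˡ : ∀ {c} p → c ≡ 0ℚ → c ·ₚ p ≋ []
·-zeroˡ {c} p c≡0 = coeffwise λ i →
  trans (coeff-· c p i) (trans (cong (ℚ._* coeff p i) c≡0) (ℚ.*-zeroˡ (coeff p i)))

·-distribˡ : ∀ c p q → c ·ₚ (p +ₚ q) ≋ c ·ₚ p +ₚ c ·ₚ q
·-distribˡ c p q = coeffwise λ i → begin
  coeff (c ·ₚ (p +ₚ q)) i                  ≡⟨ trans (coeff-· c (p +ₚ q) i) (cong (c ℚ.*_) (coeff-+ p q i)) ⟩
  c ℚ.* (coeff p i ℚ.+ coeff q i)          ≡⟨ ℚ.*-distribˡ-+ c _ _ ⟩
  c ℚ.* coeff p i ℚ.+ c ℚ.* coeff q i      ≡⟨ trans (coeff-+ (c ·ₚ p) (c ·ₚ q) i) (cong₂ ℚ._+_ (coeff-· c p i) (coeff-· c q i)) ⟨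
  coeff (c ·ₚ p +ₚ c ·ₚ q) i               ∎
  where open ≡-Reasoning

·-distribʳ : ∀ c d p → (c ℚ.+ d) ·ₚ p ≋ c ·ₚ p +ₚ d ·ₚ p
·-distribʳ c d p = coeffwise λ i → begin
  coeff ((c ℚ.+ d) ·ₚ p) i               ≡⟨ coeff-· (c ℚ.+ d) p i ⟩
  (c ℚ.+ d) ℚ.* coeff p i                ≡⟨ ℚ.*-distribʳ-+ (coeff p i) c d ⟩
  c ℚ.* coeff p i ℚ.+ d ℚ.* coeff p i    ≡⟨ trans (coeff-+ (c ·ₚ p) (d ·ₚ p) i) (cong₂ ℚ._+_ (coeff-· c p i) (coeff-· d p i)) ⟨
  coeff (c ·ₚ p +ₚ d ·ₚ p) i             ∎
  where open ≡-Reasoning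

·-assoc : ∀ c d p → c ·ₚ (d ·ₚ p) ≋ (c ℚ.* d) ·ₚ p
·-assoc c d p = coeffwise λ i → trans (coeff-· c (d ·ₚ p) i) (trans (cong (c ℚ.*_) (coeff-· d p i))
  (trans (sym (ℚ.*-assoc c d (coeff p i))) (sym (coeff-· (c ℚ.* d) p i))))

·-identityˡ : ∀ p → 1ℚ ·ₚ p ≋ p
·-identityˡ p = coeffwise λ i → trans (coeff-· 1ℚ p i) (ℚ.*-identityˡ (coeff p i))

*-zeroˡ : ∀ p q → p ≋ [] → p *ₚ q ≋ []
*-zeroˡ []      q p≋0 = ≋-refl
*-zeroˡ (a ∷ p) q p≋0 =
  +-cong (·-zeroˡ q (∷-≋-[]-head p≋0)) (∷-≋-[] refl (*-zeroˡ p q (∷-≋-[]-tail p≋0)))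

*-zeroʳ : ∀ p → p *ₚ [] ≋ []
*-zeroʳ []      = ≋-refl
*-zeroʳ (b ∷ q) = ∷-≋-[] refl (*-zeroʳ q)

*-congˡ : ∀ p p′ q → p ≋ p′ → p *ₚ q ≋ p′ *ₚ q
*-congˡ []      p′       q p≋p′ = ≋-sym (*-zeroˡ p′ q (≋-sym p≋p′))
*-congˡ (a ∷ p) []       q p≋p′ = *-zeroˡ (a ∷ p) q p≋p′
*-congˡ (a ∷ p) (b ∷ p′) q p≋p′ =
  +-cong (·-cong (∷-injectiveˡ p≋p′) ≋-refl) (∷-cong refl (*-congˡ p p′ q (∷-injectiveʳ p≋p′)))

*-congʳ : ∀ p {q q′} → q ≋ q′ → p *ₚ q ≋ p *ₚ q′
*-congʳ []      q≋q′ = ≋-refl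
*-congʳ (a ∷ p) q≋q′ = +-cong (·-cong {c = a} refl q≋q′) (∷-cong refl (*-congʳ p q≋q′))

*-cong : ∀ {p p′ q q′} → p ≋ p′ → q ≋ q′ → p *ₚ q ≋ p′ *ₚ q′
*-cong {p} {p′} {q} p≋p′ q≋q′ = ≋-trans (*-congˡ p p′ q p≋p′) (*-congʳ p′ q≋q′)

0∷-* : ∀ p q → (0ℚ ∷ p) *ₚ q ≋ 0ℚ ∷ (p *ₚ q)
0∷-* p q = +-cong (·-zeroˡ q refl) ≋-refl

*-∷ : ∀ p b q → p *ₚ (b ∷ q) ≋ b ·ₚ p +ₚ (0ℚ ∷ (p *ₚ q))
*-∷ []      b q = ≋-sym (∷-≋-[] refl ≋-refl)
*-∷ (a ∷ p) b q = ∷-cong (cong (ℚ._+ 0ℚ) (ℚ.*-comm a b))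
  (≋-trans (+-cong ≋-refl (*-∷ p b q)) (+-swapˡ (a ·ₚ q) (b ·ₚ p) (0ℚ ∷ (p *ₚ q))))

*-comm : ∀ p q → p *ₚ q ≋ q *ₚ p
*-comm []      q = ≋-sym (*-zeroʳ q)
*-comm (a ∷ p) q = ≋-trans (+-cong ≋-refl (∷-cong refl (*-comm p q))) (≋-sym (*-∷ q a p))

*-distribʳ : ∀ p q r → (p +ₚ q) *ₚ r ≋ p *ₚ r +ₚ q *ₚ r
*-distribʳ []      q       r = ≋-refl
*-distribʳ (a ∷ p) []      r = ≋-sym (+-identityʳ _)
*-distribʳ (a ∷ p) (b ∷ q) r = begin
  (a ℚ.+ b) ·ₚ r +ₚ (0ℚ ∷ ((p +ₚ q) *ₚ r))
    ≈⟨ +-cong (·-distribʳ a b r) (∷-cong (sym (ℚ.+-identityʳ 0ℚ)) (*-distribʳ p q r)) ⟩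
  (a ·ₚ r +ₚ b ·ₚ r) +ₚ ((0ℚ ∷ (p *ₚ r)) +ₚ (0ℚ ∷ (q *ₚ r)))
    ≈⟨ +-interchange (a ·ₚ r) (b ·ₚ r) (0ℚ ∷ (p *ₚ r)) (0ℚ ∷ (q *ₚ r)) ⟩
  (a ·ₚ r +ₚ (0ℚ ∷ (p *ₚ r))) +ₚ (b ·ₚ r +ₚ (0ℚ ∷ (q *ₚ r))) ∎
  where open import Relation.Binary.Reasoning.Setoid ≋-setoid

*-distribˡ : ∀ r p q → r *ₚ (p +ₚ q) ≋ r *ₚ p +ₚ r *ₚ q
*-distribˡ r p q = ≋-trans (*-comm r (p +ₚ q))
  (≋-trans (*-distribʳ p q r) (+-cong (*-comm p r) (*-comm q r)))

·-* : ∀ c q r → (c ·ₚ q) *ₚ r ≋ c ·ₚ (q *ₚ r)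
·-* c []      r = ≋-refl
·-* c (b ∷ q) r = ≋-trans (+-cong (≋-sym (·-assoc c b r)) (∷-cong (sym (ℚ.*-zeroʳ c)) (·-* c q r)))
  (≋-sym (·-distribˡ c (b ·ₚ r) (0ℚ ∷ (q *ₚ r))))

*-assoc : ∀ p q r → (p *ₚ q) *ₚ r ≋ p *ₚ (q *ₚ r)
*-assoc []      q r = ≋-refl
*-assoc (a ∷ p) q r = ≋-trans (*-distribʳ (a ·ₚ q) (0ℚ ∷ (p *ₚ q)) r)
  (+-cong (·-* a q r) (≋-trans (0∷-* (p *ₚ q) r) (∷-cong refl (*-assoc p q r))))

*-identityˡ : ∀ p → (1ℚ ∷ []) *ₚ p ≋ p
*-identityˡ p = ≋-trans (+-cong (·-identityˡ p) (∷-≋-[] refl ≋-refl)) (+-identityʳ p)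

*-identityʳ : ∀ p → p *ₚ (1ℚ ∷ []) ≋ p
*-identityʳ p = ≋-trans (*-comm p _) (*-identityˡ p)

ℚ[x] : CommutativeRing _ _
ℚ[x] = record
  { Carrier = PolyQ ; _≈_ = _≋_ ; _+_ = _+ₚ_ ; _*_ = _*ₚ_ ; -_ = -ₚ_ ; 0# = [] ; 1# = 1ℚ ∷ []
  ; isCommutativeRing = record
    { isRing = record
      { +-isAbelianGroup = record
        { isGroup = record
          { isMonoid = record
            { isSemigroup = record
              { isMagma = record { isEquivalence = Setoid.isEquivalence ≋-setoid ; ∙-cong = +-cong }
              ; assoc = +-assoc }
            ; identity = (λ _ → ≋-refl) , +-identityʳ }
          ; inverse = +-inverseˡ , λ p → ≋-trans (+-comm p (-ₚ p)) (+-inverseˡ p)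
          ; ⁻¹-cong = neg-cong }
        ; comm = +-comm }
      ; *-cong = *-cong
      ; *-assoc = *-assoc
      ; *-identity = *-identityˡ , *-identityʳ
      ; distrib = *-distribˡ , λ r p q → *-distribʳ p q r }
    ; *-comm = *-comm } }

open Algebra.Properties.Semiring.Exp (CommutativeRing.semiring ℚ[x]) using (^-congˡ) renaming (_^_ to _^ₚ_)

[_] : ℚ → PolyQ
[ c ] = c ∷ []

[]-homomorphism : CommutativeRing.rawRing ℚ.+-*-commutativeRing
                    ACR.-Raw-AlmostCommutative⟶ ACR.fromCommutativeRing ℚ[x]
[]-homomorphism = record
  { ⟦_⟧    = [_]
  ; +-homo = λ _ _ → ≋-refl
  ; *-homo = λ a b → ∷-cong (sym (ℚ.+-identityʳ (a ℚ.* b))) ≋-refl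
  ; -‿homo = λ _ → ≋-refl
  ; 0-homo = ∷-≋-[] refl ≋-refl
  ; 1-homo = ≋-refl }

[]-≟ : ∀ a b → Maybe ([ a ] ≋ [ b ])
[]-≟ a b with a ℚ.≟ b
... | yes a≡b = just (∷-cong a≡b ≋-refl)
... | no  _   = nothing

module ℚ[x]-Solver = Algebra.Solver.Ring
  (CommutativeRing.rawRing ℚ.+-*-commutativeRing) (ACR.fromCommutativeRing ℚ[x]) []-homomorphism []-≟

xpow : ℕ → PolyQ
xpow n = replicate n 0ℚ ++ [ 1ℚ ]

xpow-+ : ∀ m n → xpow (m + n) ≋ xpow m *ₚ xpow n
xpow-+ zero    n = ≋-sym (*-identityˡ (xpow n))
xpow-+ (suc m) n = ≋-sym (≋-trans (0∷-* (xpow m) (xpow n)) (∷-cong refl (≋-sym (xpow-+ m n))))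

xpow-* : ∀ k n → xpow (k * n) ≋ xpow n ^ₚ k
xpow-* zero    n = ≋-refl
xpow-* (suc k) n = ≋-trans (xpow-+ n (k * n)) (*-congʳ (xpow n) (xpow-* k n))

-- Degree bounds

record DegreeBelow (n : ℕ) (p : PolyQ) : Set where
  constructor degreeBelow
  field vanishes : ∀ i → n ≤ i → coeff p i ≡ 0ℚ
open DegreeBelow

MonicOfDegree : ℕ → PolyQ → Set
MonicOfDegree n p = DegreeBelow (suc n) p × coeff p n ≡ 1ℚ

DegreeBelow-≋ : ∀ {n p q} → p ≋ q → DegreeBelow n p → DegreeBelow n q
DegreeBelow-≋ (coeffwise e) (degreeBelow v) = degreeBelow λ i n≤i → trans (sym (e i)) (v i n≤i)

DegreeBelow-mono : ∀ {m n p} → m ≤ n → DegreeBelow m p → DegreeBelow n p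
DegreeBelow-mono m≤n (degreeBelow v) = degreeBelow λ i n≤i → v i (ℕ.≤-trans m≤n n≤i)

DegreeBelow-+ : ∀ {n p q} → DegreeBelow n p → DegreeBelow n q → DegreeBelow n (p +ₚ q)
DegreeBelow-+ {n} {p} {q} (degreeBelow v) (degreeBelow w) = degreeBelow λ i n≤i →
  trans (coeff-+ p q i) (trans (cong₂ ℚ._+_ (v i n≤i) (w i n≤i)) (ℚ.+-identityʳ 0ℚ))

DegreeBelow-· : ∀ {n p} c → DegreeBelow n p → DegreeBelow n (c ·ₚ p)
DegreeBelow-· {n} {p} c (degreeBelow v) = degreeBelow λ i n≤i →
  trans (coeff-· c p i) (trans (cong (c ℚ.*_) (v i n≤i)) (ℚ.*-zeroʳ c))

DegreeBelow-tail : ∀ {n c p} → DegreeBelow (suc n) (c ∷ p) → DegreeBelow n p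
DegreeBelow-tail (degreeBelow v) = degreeBelow λ i n≤i → v (suc i) (s≤s n≤i)

DegreeBelow-0 : ∀ {p} → DegreeBelow 0 p → p ≋ []
DegreeBelow-0 (degreeBelow v) = coeffwise λ i → v i z≤n

DegreeBelow-length : ∀ p → DegreeBelow (length p) p
DegreeBelow-length []      = degreeBelow λ _ _ → refl
DegreeBelow-length (a ∷ p) = degreeBelow λ { (suc i) (s≤s n≤i) → vanishes (DegreeBelow-length p) i n≤i }

DegreeBelow-const : ∀ c → DegreeBelow 1 [ c ]
DegreeBelow-const c = degreeBelow λ { (suc i) _ → refl }

xpow-monic : ∀ n → MonicOfDegree n (xpow n)
xpow-monic zero    = DegreeBelow-const 1ℚ , refl
xpow-monic (suc n) with xpow-monic n
... | degreeBelow v , top = degreeBelow (λ { (suc i) (s≤s n≤i) → v i n≤i }) , top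

monic-+ : ∀ {n p q} → MonicOfDegree n p → DegreeBelow n q → MonicOfDegree n (p +ₚ q)
monic-+ {n} {p} {q} (p<n+1 , top) q<n = DegreeBelow-+ p<n+1 (DegreeBelow-mono (ℕ.n≤1+n n) q<n)
  , trans (coeff-+ p q n) (trans (cong₂ ℚ._+_ top (vanishes q<n n ℕ.≤-refl)) (ℚ.+-identityʳ 1ℚ))

coeff-*-top : ∀ {m n} s f → DegreeBelow (suc m) s → DegreeBelow (suc n) f →
              coeff (s *ₚ f) (m + n) ≡ coeff s m ℚ.* coeff f n
coeff-*-top {m}     {n} []      f s<m+1 f<n+1 = sym (ℚ.*-zeroˡ (coeff f n))
coeff-*-top {zero}  {n} (c ∷ s) f s<1   f<n+1 = begin
  coeff ((c ∷ s) *ₚ f) n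
    ≡⟨ coeff-+ (c ·ₚ f) (0ℚ ∷ (s *ₚ f)) n ⟩
  coeff (c ·ₚ f) n ℚ.+ coeff (0ℚ ∷ (s *ₚ f)) n
    ≡⟨ cong₂ ℚ._+_ (coeff-· c f n) (coeff-≡ (∷-≋-[] refl (*-zeroˡ s f (DegreeBelow-0 (DegreeBelow-tail s<1)))) n) ⟩
  c ℚ.* coeff f n ℚ.+ 0ℚ
    ≡⟨ ℚ.+-identityʳ _ ⟩
  c ℚ.* coeff f n ∎
  where open ≡-Reasoning
coeff-*-top {suc m} {n} (c ∷ s) f s<m+2 f<n+1 = begin
  coeff ((c ∷ s) *ₚ f) (suc m + n)
    ≡⟨ coeff-+ (c ·ₚ f) (0ℚ ∷ (s *ₚ f)) (suc m + n) ⟩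
  coeff (c ·ₚ f) (suc m + n) ℚ.+ coeff (s *ₚ f) (m + n)
    ≡⟨ cong₂ ℚ._+_ (vanishes (DegreeBelow-· c f<n+1) (suc m + n) (s≤s (ℕ.m≤n+m n m)))
                   (coeff-*-top s f (DegreeBelow-tail s<m+2) f<n+1) ⟩
  0ℚ ℚ.+ coeff s m ℚ.* coeff f n
    ≡⟨ ℚ.+-identityˡ _ ⟩
  coeff s m ℚ.* coeff f n ∎
  where open ≡-Reasoning

-- Integrality

toℚᵘ-toℚ : ∀ z → ℚ.toℚᵘ (toℚ z) ℚᵘ.≃ mkℚᵘ z 0
toℚᵘ-toℚ z = ℚ.toℚᵘ-fromℚᵘ (mkℚᵘ z 0)

toℚ-+ : ∀ a b → toℚ (a ℤ.+ b) ≡ toℚ a ℚ.+ toℚ b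
toℚ-+ a b = ℚ.toℚᵘ-injective (ℚᵘ.≃-trans (toℚᵘ-toℚ (a ℤ.+ b)) (ℚᵘ.≃-sym
  (ℚᵘ.≃-trans (ℚ.toℚᵘ-homo-+ (toℚ a) (toℚ b))
  (ℚᵘ.≃-trans (ℚᵘ.+-cong (toℚᵘ-toℚ a) (toℚᵘ-toℚ b)) (*≡* (cross a b))))))
  where
  cross : ∀ a b → (a ℤ.* + 1 ℤ.+ b ℤ.* + 1) ℤ.* + 1 ≡ (a ℤ.+ b) ℤ.* (+ 1 ℤ.* + 1)
  cross a b rewrite ℤ.*-identityʳ a | ℤ.*-identityʳ b | ℤ.*-identityʳ (a ℤ.+ b) = refl

toℚ-* : ∀ a b → toℚ (a ℤ.* b) ≡ toℚ a ℚ.* toℚ b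
toℚ-* a b = ℚ.toℚᵘ-injective (ℚᵘ.≃-trans (toℚᵘ-toℚ (a ℤ.* b)) (ℚᵘ.≃-sym
  (ℚᵘ.≃-trans (ℚ.toℚᵘ-homo-* (toℚ a) (toℚ b))
  (ℚᵘ.≃-trans (ℚᵘ.*-cong (toℚᵘ-toℚ a) (toℚᵘ-toℚ b)) (*≡* refl)))))

toℚ-neg : ∀ a → toℚ (ℤ.- a) ≡ ℚ.- toℚ a
toℚ-neg a = ℚ.toℚᵘ-injective (ℚᵘ.≃-trans (toℚᵘ-toℚ (ℤ.- a)) (ℚᵘ.≃-sym
  (ℚᵘ.≃-trans (ℚ.toℚᵘ-homo‿- (toℚ a)) (ℚᵘ.≃-trans (ℚᵘ.-‿cong (toℚᵘ-toℚ a)) (*≡* refl)))))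

IsInt : ℚ → Set
IsInt x = Σ ℤ λ z → x ≡ toℚ z

½-not-int : ¬ IsInt ½
½-not-int (z , ½≡z) with ℚᵘ.≃-trans (ℚ.toℚᵘ-cong ½≡z) (toℚᵘ-toℚ z)
... | *≡* 1≡2z = odd≢even z 1≡2z
  where
  odd≢even : ∀ z → + 1 ℤ.* + 1 ≢ z ℤ.* + 2
  odd≢even (+ 0)       ()
  odd≢even (+ (suc n)) ()
  odd≢even ℤ.-[1+ n ]  ()

isInt-+ : ∀ {x y} → IsInt x → IsInt y → IsInt (x ℚ.+ y)
isInt-+ (a , refl) (b , refl) = a ℤ.+ b , sym (toℚ-+ a b)

isInt-* : ∀ {x y} → IsInt x → IsInt y → IsInt (x ℚ.* y)
isInt-* (a , refl) (b , refl) = a ℤ.* b , sym (toℚ-* a b)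

isInt-neg : ∀ {x} → IsInt x → IsInt (ℚ.- x)
isInt-neg (a , refl) = ℤ.- a , sym (toℚ-neg a)

isInt-≡ : ∀ {x y} → x ≡ y → IsInt x → IsInt y
isInt-≡ refl x∈ℤ = x∈ℤ

record Integral (p : PolyQ) : Set where
  constructor integral
  field coeff-isInt : ∀ i → IsInt (coeff p i)
open Integral

Integral-≋ : ∀ {p q} → p ≋ q → Integral p → Integral q
Integral-≋ (coeffwise e) (integral c) = integral λ i → isInt-≡ (e i) (c i)

Integral-+ : ∀ {p q} → Integral p → Integral q → Integral (p +ₚ q)
Integral-+ {p} {q} (integral c) (integral d) = integral λ i → isInt-≡ (sym (coeff-+ p q i)) (isInt-+ (c i) (d i))

Integral-· : ∀ {c p} → IsInt c → Integral p → Integral (c ·ₚ p)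
Integral-· {c} {p} c∈ℤ (integral d) = integral λ i → isInt-≡ (sym (coeff-· c p i)) (isInt-* c∈ℤ (d i))

Integral-neg : ∀ {p} → Integral p → Integral (-ₚ p)
Integral-neg {p} (integral c) = integral λ i → isInt-≡ (sym (coeff-neg p i)) (isInt-neg (c i))

Integral-0∷ : ∀ {p} → Integral p → Integral (0ℚ ∷ p)
Integral-0∷ (integral c) = integral λ { zero → + 0 , refl ; (suc i) → c i }

Integral-* : ∀ {p q} → Integral p → Integral q → Integral (p *ₚ q)
Integral-* {[]}    _            _   = integral λ _ → + 0 , refl
Integral-* {a ∷ p} (integral c) q∈ℤ =
  Integral-+ (Integral-· (c zero) q∈ℤ) (Integral-0∷ (Integral-* {p} (integral λ i → c (suc i)) q∈ℤ))

Integral-toQ[x] : ∀ q → Integral (toQ[x] q)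
Integral-toQ[x] []      = integral λ _ → + 0 , refl
Integral-toQ[x] (a ∷ q) = integral λ { zero → a , refl ; (suc i) → coeff-isInt (Integral-toQ[x] q) i }

toQ[x]-monomial : ∀ n c → toQ[x] (monomial n c) ≋ toℚ c ·ₚ xpow n
toQ[x]-monomial zero    c = ∷-cong (sym (ℚ.*-identityʳ (toℚ c))) ≋-refl
toQ[x]-monomial (suc n) c = ∷-cong (sym (ℚ.*-zeroʳ (toℚ c))) (toQ[x]-monomial n c)

Integral-xpow : ∀ n → Integral (xpow n)
Integral-xpow n =
  Integral-≋ (≋-trans (toQ[x]-monomial n (+ 1)) (·-identityˡ (xpow n))) (Integral-toQ[x] (monomial n (+ 1)))

-- Division by a monic integral polynomial

leading-term : ℕ → PolyQ → PolyQ
leading-term m s = coeff s m ·ₚ xpow m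

drop-leading-term : ∀ {m s} → DegreeBelow (suc m) s → DegreeBelow m (s -ₚ leading-term m s)
drop-leading-term {m} {s} (degreeBelow v) = degreeBelow vanish
  where
  c = coeff s m
  vanish : ∀ i → m ≤ i → coeff (s -ₚ leading-term m s) i ≡ 0ℚ
  vanish i m≤i with ℕ.m≤n⇒m<n∨m≡n m≤i
  ... | inj₁ m<i = begin
    coeff (s -ₚ leading-term m s) i            ≡⟨ trans (coeff-+ s _ i) (cong (coeff s i ℚ.+_) (coeff-neg (leading-term m s) i)) ⟩
    coeff s i ℚ.- coeff (c ·ₚ xpow m) i        ≡⟨ cong₂ ℚ._-_ (v i m<i) (vanishes (DegreeBelow-· c (proj₁ (xpow-monic m))) i m<i) ⟩
    0ℚ ℚ.- 0ℚ                                  ≡⟨⟩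
    0ℚ                                         ∎
    where open ≡-Reasoning
  ... | inj₂ refl = begin
    coeff (s -ₚ leading-term m s) m            ≡⟨ trans (coeff-+ s _ m) (cong (c ℚ.+_) (coeff-neg (leading-term m s) m)) ⟩
    c ℚ.- coeff (c ·ₚ xpow m) m                ≡⟨ cong (λ t → c ℚ.- t) (trans (coeff-· c (xpow m) m) (cong (c ℚ.*_) (proj₂ (xpow-monic m)))) ⟩
    c ℚ.- c ℚ.* 1ℚ                             ≡⟨ cong (λ t → c ℚ.- t) (ℚ.*-identityʳ c) ⟩
    c ℚ.- c                                    ≡⟨ ℚ.+-inverseʳ c ⟩
    0ℚ                                         ∎
    where open ≡-Reasoning

module _ {n f} (f-monic : MonicOfDegree n f) (f∈ℤ : Integral f) where

  -- The leading coefficient of s is that of s·f in degree m + n; subtract its term and recurse.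
  integral-cofactor : ∀ m s → DegreeBelow m s →
                      (∀ i → n ≤ i → IsInt (coeff (s *ₚ f) i)) → Integral s
  integral-cofactor zero    s s<0   _       = integral λ i → isInt-≡ (sym (vanishes s<0 i z≤n)) (+ 0 , refl)
  integral-cofactor (suc m) s s<m+1 sf-high = Integral-≋ s′+t≋s (Integral-+ s′∈ℤ t∈ℤ)
    where
    c = coeff s m
    t = leading-term m s
    s′ = s -ₚ t

    c∈ℤ : IsInt c
    c∈ℤ = isInt-≡ (trans (coeff-*-top s f s<m+1 (proj₁ f-monic))
                         (trans (cong (c ℚ.*_) (proj₂ f-monic)) (ℚ.*-identityʳ c)))
                  (sf-high (m + n) (ℕ.m≤n+m n m))
    t∈ℤ : Integral t
    t∈ℤ = Integral-· c∈ℤ (Integral-xpow m)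

    s′f-high : ∀ i → n ≤ i → IsInt (coeff (s′ *ₚ f) i)
    s′f-high i n≤i = isInt-≡ (sym (trans (coeff-≡ (*-distribʳ s (-ₚ t) f) i) (coeff-+ (s *ₚ f) _ i)))
      (isInt-+ (sf-high i n≤i) (coeff-isInt (Integral-* (Integral-neg t∈ℤ) f∈ℤ) i))

    s′∈ℤ : Integral s′
    s′∈ℤ = integral-cofactor m s′ (drop-leading-term s<m+1) s′f-high

    s′+t≋s : s′ +ₚ t ≋ s
    s′+t≋s = ≋-trans (+-assoc s (-ₚ t) t) (≋-trans (+-cong ≋-refl (+-inverseˡ t)) (+-identityʳ s))

ℤ[θ]-low-degree-integral : ∀ {n} f p → MonicOfDegree n (toQ[x] f) → DegreeBelow n p → InZθ f p → Integral p
ℤ[θ]-low-degree-integral {n} f p f-monic p<n (q , s , fs≋p-q) =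
  Integral-≋ p-q+q≋p (Integral-+ (Integral-≋ (coeffwise fs≋p-q) (Integral-* f∈ℤ s∈ℤ)) (Integral-toQ[x] q))
  where
  f∈ℤ = Integral-toQ[x] f
  q′ = toQ[x] q

  sf-high : ∀ i → n ≤ i → IsInt (coeff (s *ₚ toQ[x] f) i)
  sf-high i n≤i = isInt-≡ (sym (begin
    coeff (s *ₚ toQ[x] f) i       ≡⟨ coeff-≡ (*-comm s (toQ[x] f)) i ⟩
    coeff (toQ[x] f *ₚ s) i       ≡⟨ fs≋p-q i ⟩
    coeff (p -ₚ q′) i             ≡⟨ coeff-+ p (-ₚ q′) i ⟩
    coeff p i ℚ.+ coeff (-ₚ q′) i ≡⟨ cong (ℚ._+ coeff (-ₚ q′) i) (vanishes p<n i n≤i) ⟩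
    0ℚ ℚ.+ coeff (-ₚ q′) i        ≡⟨ ℚ.+-identityˡ _ ⟩
    coeff (-ₚ q′) i               ∎))
    (coeff-isInt (Integral-neg (Integral-toQ[x] q)) i)
    where open ≡-Reasoning

  s∈ℤ : Integral s
  s∈ℤ = integral-cofactor f-monic f∈ℤ (length s) s (DegreeBelow-length s) sf-high

  p-q+q≋p : (p -ₚ q′) +ₚ q′ ≋ p
  p-q+q≋p = ≋-trans (+-assoc p (-ₚ q′) q′) (≋-trans (+-cong ≋-refl (+-inverseˡ q′)) (+-identityʳ p))

-- The algebraic integer (1 + z + z²)/2

ι : ℤ → PolyQ
ι z = [ toℚ z ]

ι-+ : ∀ a b → ι (a ℤ.+ b) ≋ ι a +ₚ ι b
ι-+ a b = ∷-cong (toℚ-+ a b) ≋-refl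

ι-* : ∀ a b → ι (a ℤ.* b) ≋ ι a *ₚ ι b
ι-* a b = ∷-cong (trans (toℚ-* a b) (sym (ℚ.+-identityʳ _))) ≋-refl

ι-neg : ∀ a → ι (ℤ.- a) ≋ -ₚ ι a
ι-neg a = ∷-cong (toℚ-neg a) ≋-refl

[]-* : ∀ c p → [ c ] *ₚ p ≋ c ·ₚ p
[]-* c p = ≋-trans (+-cong ≋-refl (∷-≋-[] refl ≋-refl)) (+-identityʳ (c ·ₚ p))

open ℚ[x]-Solver using (Polynomial; con; var; _:+_; _:*_; _:-_; _:^_; ⟦_⟧; prove)

horner : List (Polynomial 2) → Polynomial 2 → Polynomial 2
horner []       y = con 0ℚ
horner (c ∷ cs) y = c :+ y :* horner cs y

compose-horner : ∀ {ρ} y gs cs → Pointwise (λ g c → ι g ≋ ⟦ c ⟧ ρ) gs cs →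
                 compose (toQ[x] gs) (⟦ y ⟧ ρ) ≋ ⟦ horner cs y ⟧ ρ
compose-horner     y []       []       []       = ≋-sym (∷-≋-[] refl ≋-refl)
compose-horner {ρ} y (g ∷ gs) (c ∷ cs) (e ∷ es) = +-cong e (*-congʳ (⟦ y ⟧ ρ) (compose-horner y gs cs es))

-- The variables stand for z = θ^(2^(k−1)) and m = (A − 1)/4.
module Expressions where
  private
    z m a : Polynomial 2
    z = var #0
    m = var (#s #0)
    a = con (toℚ (+ 4)) :* m :+ con 1ℚ

  quartic half cofactor : Polynomial 2
  quartic  = (z :^ 2) :^ 2 :+ (a :* z :^ 2 :+ a)
  half     = con ½ :* (con 1ℚ :+ z :+ z :^ 2)
  cofactor = (con (+ 3 ℚ./ 16) :+ con ½ :* m) :+ (con (+ 3 ℚ./ 8) :+ con ½ :* m) :* z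
           :+ (con (+ 7 ℚ./ 16) :+ con (+ 1 ℚ./ 4) :* m) :* z :^ 2
           :+ con (+ 1 ℚ./ 4) :* z :^ 3 :+ con (+ 1 ℚ./ 16) :* z :^ 4

  minpoly-coeffs : List (Polynomial 2)
  minpoly-coeffs = m :* m ∷ m :+ m ∷ (con (toℚ (+ 4)) :* m :- con 1ℚ) :* m :+ con 1ℚ
                 ∷ con (toℚ (+ 4)) :* m :- con 1ℚ ∷ con 1ℚ ∷ []

  half-is-root : ∀ ρ → ⟦ quartic :* cofactor ⟧ ρ ≋ ⟦ horner minpoly-coeffs half ⟧ ρ
  half-is-root ρ = prove ρ (quartic :* cofactor) (horner minpoly-coeffs half) ≋-refl

half-element : PolyQ → PolyQ
half-element z = [ ½ ] *ₚ (([ 1ℚ ] +ₚ z) +ₚ z ^ₚ 2)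

-- y⁴ + (A−2)y³ + ((A−2)m+1)y² + 2my + m²: with u = 1 + z², the element y = (1 + z + z²)/2
-- satisfies y² = u(y + m) and u² + (A−2)u + 1 = 0; eliminate u.
minpoly : ℤ → MonicZ
minpoly m = m ℤ.* m ∷ m ℤ.+ m ∷ (+ 4 ℤ.* m ℤ.- + 1) ℤ.* m ℤ.+ + 1 ∷ + 4 ℤ.* m ℤ.- + 1 ∷ []

ι-minpoly : ∀ z m → Pointwise (λ g c → ι g ≋ ⟦ c ⟧ (z ∷ ι m ∷ []))
                              (monicPoly (minpoly m)) Expressions.minpoly-coeffs
ι-minpoly z m = ι-* m m ∷ ι-+ m m ∷ g₂≋ ∷ g₃≋ ∷ ≋-refl ∷ []
  where
  g₃ = + 4 ℤ.* m ℤ.- + 1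
  g₃≋ : ι g₃ ≋ ι (+ 4) *ₚ ι m +ₚ -ₚ [ 1ℚ ]
  g₃≋ = ≋-trans (ι-+ (+ 4 ℤ.* m) (ℤ.- + 1)) (+-cong (ι-* (+ 4) m) (ι-neg (+ 1)))
  g₂≋ : ι (g₃ ℤ.* m ℤ.+ + 1) ≋ (ι (+ 4) *ₚ ι m +ₚ -ₚ [ 1ℚ ]) *ₚ ι m +ₚ [ 1ℚ ]
  g₂≋ = ≋-trans (ι-+ (g₃ ℤ.* m) (+ 1)) (+-cong (≋-trans (ι-* g₃ m) (*-congˡ (ι g₃) _ (ι m) g₃≋)) (≋-refl {[ 1ℚ ]}))

half-element-isAlgInt : ∀ f z m → toQ[x] f ≋ ⟦ Expressions.quartic ⟧ (z ∷ ι m ∷ []) →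
                        IsAlgInt f (half-element z)
half-element-isAlgInt f z m f≋quartic = minpoly m , ⟦ cofactor ⟧ ρ , coeff-≡ (begin
  toQ[x] f *ₚ ⟦ cofactor ⟧ ρ                                ≈⟨ *-congˡ _ _ _ f≋quartic ⟩
  ⟦ quartic :* cofactor ⟧ ρ                                 ≈⟨ half-is-root ρ ⟩
  ⟦ horner minpoly-coeffs half ⟧ ρ                          ≈⟨ compose-horner half _ _ (ι-minpoly z m) ⟨
  compose (toQ[x] (monicPoly (minpoly m))) (half-element z) ∎)
  where
  open Expressions using (quartic; cofactor; half; minpoly-coeffs; half-is-root)
  open import Relation.Binary.Reasoning.Setoid ≋-setoid
  ρ = z ∷ ι m ∷ []

toQ[x]-+z : ∀ p q → toQ[x] (p +z q) ≋ toQ[x] p +ₚ toQ[x] q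
toQ[x]-+z []      q       = ≋-refl
toQ[x]-+z (a ∷ p) []      = ≋-sym (+-identityʳ _)
toQ[x]-+z (a ∷ p) (b ∷ q) = ∷-cong (toℚ-+ a b) (toQ[x]-+z p q)

toQ[x]-fPoly : ∀ k A → toQ[x] (fPoly k A) ≋ xpow (2 ^ suc k) +ₚ (toℚ A ·ₚ xpow (2 ^ k) +ₚ [ toℚ A ])
toQ[x]-fPoly k A =
  ≋-trans (toQ[x]-+z (monomial (2 ^ suc k) (+ 1)) (monomial (2 ^ k) A +z monomial 0 A))
    (+-cong (≋-trans (toQ[x]-monomial (2 ^ suc k) (+ 1)) (·-identityˡ _))
      (≋-trans (toQ[x]-+z (monomial (2 ^ k) A) (monomial 0 A)) (+-cong (toQ[x]-monomial (2 ^ k) A) ≋-refl)))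

2^k<2^[k+1] : ∀ k → 2 ^ k < 2 ^ suc k
2^k<2^[k+1] k = ℕ.^-monoʳ-< 2 (s≤s (s≤s z≤n)) (ℕ.n<1+n k)

monic-≋ : ∀ {n p q} → p ≋ q → MonicOfDegree n p → MonicOfDegree n q
monic-≋ {n} p≋q (p<n+1 , top) = DegreeBelow-≋ p≋q p<n+1 , trans (sym (coeff-≡ p≋q n)) top

fPoly-monic : ∀ k A → MonicOfDegree (2 ^ suc k) (toQ[x] (fPoly k A))
fPoly-monic k A = monic-≋ (≋-sym (toQ[x]-fPoly k A)) (monic-+ (xpow-monic (2 ^ suc k))
  (DegreeBelow-+ (DegreeBelow-mono (2^k<2^[k+1] k) (DegreeBelow-· (toℚ A) (proj₁ (xpow-monic (2 ^ k)))))
                 (DegreeBelow-mono (ℕ.m^n>0 2 (suc k)) (DegreeBelow-const (toℚ A)))))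

fPoly-quartic : ∀ k A m → A ≡ + 4 ℤ.* m ℤ.+ + 1 →
                toQ[x] (fPoly (suc k) A) ≋ ⟦ Expressions.quartic ⟧ (xpow (2 ^ k) ∷ ι m ∷ [])
fPoly-quartic k A m refl = ≋-trans (toQ[x]-fPoly (suc k) A) (+-cong z⁴ (+-cong az² ιA))
  where
  N = 2 ^ k
  ιA : ι A ≋ ι (+ 4) *ₚ ι m +ₚ [ 1ℚ ]
  ιA = ≋-trans (ι-+ (+ 4 ℤ.* m) (+ 1)) (+-cong (ι-* (+ 4) m) (≋-refl {[ 1ℚ ]}))
  z⁴ : xpow (2 * (2 * N)) ≋ (xpow N ^ₚ 2) ^ₚ 2
  z⁴ = ≋-trans (xpow-* 2 (2 * N)) (^-congˡ 2 (xpow-* 2 N))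
  az² : toℚ A ·ₚ xpow (2 * N) ≋ (ι (+ 4) *ₚ ι m +ₚ [ 1ℚ ]) *ₚ xpow N ^ₚ 2
  az² = ≋-trans (·-cong {c = toℚ A} refl (xpow-* 2 N)) (≋-trans (≋-sym ([]-* (toℚ A) _)) (*-congˡ (ι A) _ _ ιA))

half-element-degree : ∀ k → DegreeBelow (2 ^ suc (suc k)) (half-element (xpow (2 ^ k)))
half-element-degree k = DegreeBelow-mono (2^k<2^[k+1] (suc k)) (DegreeBelow-≋ (≋-sym ([]-* ½ _))
  (DegreeBelow-· ½ (DegreeBelow-+ (DegreeBelow-+ one z) z²)))
  where
  N = 2 ^ k
  one : DegreeBelow (suc (2 * N)) [ 1ℚ ]
  one = DegreeBelow-mono (s≤s z≤n) (DegreeBelow-const 1ℚ)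
  z : DegreeBelow (suc (2 * N)) (xpow N)
  z = DegreeBelow-mono (s≤s (ℕ.m≤m+n N (N + 0))) (proj₁ (xpow-monic N))
  z² : DegreeBelow (suc (2 * N)) (xpow N ^ₚ 2)
  z² = DegreeBelow-≋ (xpow-* 2 N) (proj₁ (xpow-monic (2 * N)))

half-element-not-integral : ∀ {N} → 0 < N → ¬ Integral (half-element (xpow N))
half-element-not-integral {suc N} _ half∈ℤ = ½-not-int (coeff-isInt half∈ℤ 0)

A≡4[A/4]+1 : ∀ A → A % + 4 ≡ 1 → A ≡ + 4 ℤ.* (A ℤ./ + 4) ℤ.+ + 1
A≡4[A/4]+1 A A%4≡1 = begin
  A                                 ≡⟨ ℤ.a≡a%n+[a/n]*n A (+ 4) ⟩
  + (A % + 4) ℤ.+ A ℤ./ + 4 ℤ.* + 4 ≡⟨ cong (λ r → + r ℤ.+ A ℤ./ + 4 ℤ.* + 4) A%4≡1 ⟩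
  + 1 ℤ.+ A ℤ./ + 4 ℤ.* + 4         ≡⟨ ℤ.+-comm (+ 1) (A ℤ./ + 4 ℤ.* + 4) ⟩
  A ℤ./ + 4 ℤ.* + 4 ℤ.+ + 1         ≡⟨ cong (ℤ._+ + 1) (ℤ.*-comm (A ℤ./ + 4) (+ 4)) ⟩
  + 4 ℤ.* (A ℤ./ + 4) ℤ.+ + 1       ∎
  where open ≡-Reasoning

corollary3p7 : (k : ℕ) (A : ℤ) → 1 ≤ k → Data.Integer._≤_ (+ 5) A → A % + 4 ≡ 1 →
    ¬ Monogenic (fPoly k A)
corollary3p7 (suc k) A _ _ A%4≡1 (_ , integral⇒ℤ[θ] , _) =
  half-element-not-integral (ℕ.m^n>0 2 k)
    (ℤ[θ]-low-degree-integral f η (fPoly-monic (suc k) A) (half-element-degree k) η∈ℤ[θ])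
  where
  f = fPoly (suc k) A
  m = A ℤ./ + 4
  η = half-element (xpow (2 ^ k))
  η∈ℤ[θ] : InZθ f η
  η∈ℤ[θ] = integral⇒ℤ[θ] η (half-element-isAlgInt f (xpow (2 ^ k)) m (fPoly-quartic k A m (A≡4[A/4]+1 A A%4≡1)))
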